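{- For every positive integer $n$, \[ 2B(n) - W(n) \;=\; n - 1 - F(n). \]
   Context: $\lg$ is the logarithm to base 2. For a real number $x$, $\mathrm{Zigzag}(x) = \min\left(x - \lfloor x \rfloor,\ \lceil x \rceil - x\right)$. $B$ is the function on positive integers defined by $B(1) = 0$ and, for $n \ge 2$, $B(n) = \lfloor n/2 \rfloor + B(\lfloor n/2 \rfloor) + B(\lceil n/2 \rceil)$ (the minimum number of key comparisons of MergeSort on $n$ elements). $W(n) = \sum_{i=1}^{n} \lceil \lg i \rceil$ (the maximum number of key comparisons of MergeSort on $n$ elements). $F(n) = \sum_{k=1}^{\lfloor \lg n \rfloor} 2^k\, \mathrm{Zigzag}\!\left(\frac{n}{2^k}\right)$. -}

module Defs where

open import Data.Nat as ℕ using (ℕ; zero; suc; _+_; _*_; _^_; ⌊_/2⌋; ⌈_/2⌉)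
open import Data.Nat.Properties using (m^n≢0)
open import Data.Nat.Logarithm using (⌊log₂_⌋; ⌈log₂_⌉)
open import Data.Integer using (ℤ; +_)
open import Data.Rational as ℚ using (ℚ; _-_; _⊓_; floor; ceiling; _/_)

Zigzag : ℚ → ℚ
Zigzag x = (x - (floor x / 1)) ⊓ ((ceiling x / 1) - x)

-- Bfuel f n computes B(n) provided f ≥ n (fuel only guarantees termination).
-- B(1) = 0 and B(n) = ⌊n/2⌋ + B(⌊n/2⌋) + B(⌈n/2⌉) for n ≥ 2. (B(0) is set to 0; never used.)
Bfuel : ℕ → ℕ → ℕ
Bfuel zero    n = 0
Bfuel (suc f) zero = 0
Bfuel (suc f) (suc zero) = 0
Bfuel (suc f) n@(suc (suc _)) = ⌊ n /2⌋ + Bfuel f ⌊ n /2⌋ + Bfuel f ⌈ n /2⌉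

B : ℕ → ℕ
B n = Bfuel n n

W : ℕ → ℕ
W zero = 0
W (suc n) = W n + ⌈log₂ suc n ⌉

_/2^_ : ℕ → ℕ → ℚ
n /2^ k = (+ n / (2 ^ k)) {{m^n≢0 2 k}}

Fsum : ℕ → ℕ → ℚ
Fsum n zero = ℚ.0ℚ
Fsum n (suc k) = Fsum n k ℚ.+ ((+ (2 ^ suc k) / 1) ℚ.* Zigzag (n /2^ suc k))

F : ℕ → ℚ
F n = Fsum n ⌊log₂ n ⌋

ℕ→ℚ : ℕ → ℚ
ℕ→ℚ n = + n / 1

module Submission where

-- Each summand 2^k · Zigzag(n / 2^k) of F(n) is the distance from n to the nearest multiple of
-- 2^k, a natural number, so the identity amounts to 2B(n) + F(n) + 1 = W(n) + n in ℕ. This is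
-- proved by induction along n = 2m, 2m + 1, using the halving recursions
--   B(2m) = m + 2B(m),          B(2m+1) = m + B(m) + B(m+1),
--   W(2m) + 1 = 2W(m) + 2m,     W(2m+1) + 1 = W(m) + W(m+1) + 2m + 1,
--   F(2m) = 2F(m),              F(2m+1) = 1 + F(m) + F(m+1).
-- The last rests on dist(2r+1, 2d) = dist(r, d) + dist(r+1, d) for even d, where dist(·, d) is
-- the distance to the nearest multiple of d.

open import Defs

module Halving where

  open import Data.Nat
  open import Data.Nat.Properties
  open import Data.Nat.Induction using (<-rec)
  open import Data.Nat.Logarithm
  open import Data.Product using (_×_; _,_)
  open import Data.Sum using (_⊎_; inj₁; inj₂)
  open import Function using (_∘_; _$_)
  open import Relation.Binary.PropositionalEquality

  even-or-odd : ∀ n → n ≡ 2 * ⌊ n /2⌋ ⊎ n ≡ suc (2 * ⌊ n /2⌋)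
  even-or-odd 0 = inj₁ refl
  even-or-odd 1 = inj₂ refl
  even-or-odd (suc (suc n)) with even-or-odd n
  ... | inj₁ e = inj₁ (trans (cong (2 +_) e) (sym (*-suc 2 ⌊ n /2⌋)))
  ... | inj₂ e = inj₂ (trans (cong (2 +_) e) (cong suc (sym (*-suc 2 ⌊ n /2⌋))))

  m<2*m : ∀ m .{{_ : NonZero m}} → m < 2 * m
  m<2*m m = m<m+n m (<-≤-trans (>-nonZero⁻¹ m) (m≤m+n m 0))

  module _ (P : ℕ → Set) (P-1 : P 1)
           (P-double : ∀ m .{{_ : NonZero m}} → P m → P (2 * m))
           (P-suc-double : ∀ m .{{_ : NonZero m}} → P m → P (suc m) → P (suc (2 * m))) where

    binary-induction : ∀ n .{{_ : NonZero n}} → P n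
    binary-induction = <-rec (λ n → .{{_ : NonZero n}} → P n) step
      where
      step : ∀ n → (∀ {m} → m < n → .{{_ : NonZero m}} → P m) → .{{_ : NonZero n}} → P n
      step 1 _ = P-1
      step n@(suc (suc k)) rec with even-or-odd n
      ... | inj₁ n≡2h = subst P (sym n≡2h) (P-double h (rec (subst (h <_) (sym n≡2h) (m<2*m h))))
        where h = ⌊ n /2⌋
      ... | inj₂ n≡1+2h = subst P (sym n≡1+2h)
              (P-suc-double h (rec (subst (h <_) (sym n≡1+2h) (m<n⇒m<1+n (m<2*m h))))
                              (rec (subst (suc h <_) (sym n≡1+2h) (s<s (m<2*m h)))))
        where h = ⌊ n /2⌋

  ⌊2*n/2⌋≡n : ∀ n → ⌊ 2 * n /2⌋ ≡ n
  ⌊2*n/2⌋≡n n = trans (cong ⌊_/2⌋ (cong (n +_) (+-identityʳ n))) (sym (n≡⌊n+n/2⌋ n))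

  ⌊[1+2*n]/2⌋≡n : ∀ n → ⌊ suc (2 * n) /2⌋ ≡ n
  ⌊[1+2*n]/2⌋≡n n = trans (cong (λ m → ⌊ suc m /2⌋) (cong (n +_) (+-identityʳ n))) (sym (n≡⌈n+n/2⌉ n))

  ⌊log₂[1+2*n]⌋≡1+⌊log₂n⌋ : ∀ n .{{_ : NonZero n}} → ⌊log₂ suc (2 * n) ⌋ ≡ 1 + ⌊log₂ n ⌋
  ⌊log₂[1+2*n]⌋≡1+⌊log₂n⌋ n = begin-equality
    ⌊log₂ suc (2 * n) ⌋               ≡⟨ suc-pred _ {{>-nonZero 0<L}} ⟨
    suc (⌊log₂ suc (2 * n) ⌋ ∸ 1)     ≡⟨ cong suc (⌊log₂⌊n/2⌋⌋≡⌊log₂n⌋∸1 (suc (2 * n))) ⟨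
    suc ⌊log₂ ⌊ suc (2 * n) /2⌋ ⌋     ≡⟨ cong (suc ∘ ⌊log₂_⌋) (⌊[1+2*n]/2⌋≡n n) ⟩
    suc ⌊log₂ n ⌋                     ∎
    where
    open ≤-Reasoning
    0<L : 0 < ⌊log₂ suc (2 * n) ⌋
    0<L = ⌊log₂⌋-mono-≤ {2} (s≤s (<-≤-trans (>-nonZero⁻¹ n) (m≤m+n n _)))

  ⌈log₂[1+2*n]⌉≡1+⌈log₂[1+n]⌉ : ∀ n .{{_ : NonZero n}} → ⌈log₂ suc (2 * n) ⌉ ≡ 1 + ⌈log₂ suc n ⌉
  ⌈log₂[1+2*n]⌉≡1+⌈log₂[1+n]⌉ n = begin-equality
    ⌈log₂ suc (2 * n) ⌉               ≡⟨ suc-pred _ {{>-nonZero 0<L}} ⟨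
    suc (⌈log₂ suc (2 * n) ⌉ ∸ 1)     ≡⟨ cong suc (⌈log₂⌈n/2⌉⌉≡⌈log₂n⌉∸1 (suc (2 * n))) ⟨
    suc ⌈log₂ suc ⌊ 2 * n /2⌋ ⌉       ≡⟨ cong (λ m → suc ⌈log₂ suc m ⌉) (⌊2*n/2⌋≡n n) ⟩
    suc ⌈log₂ suc n ⌉                 ∎
    where
    open ≤-Reasoning
    0<L : 0 < ⌈log₂ suc (2 * n) ⌉
    0<L = ⌈log₂⌉-mono-≤ {2} (s≤s (<-≤-trans (>-nonZero⁻¹ n) (m≤m+n n _)))

  2^⌊log₂n⌋≤n : ∀ n .{{_ : NonZero n}} → 2 ^ ⌊log₂ n ⌋ ≤ n
  2^⌊log₂n⌋≤n = binary-induction (λ n → 2 ^ ⌊log₂ n ⌋ ≤ n) ≤-refl double suc-double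
    where
    double : ∀ m .{{_ : NonZero m}} → 2 ^ ⌊log₂ m ⌋ ≤ m → 2 ^ ⌊log₂ (2 * m) ⌋ ≤ 2 * m
    double m ih = subst (λ k → 2 ^ k ≤ 2 * m) (sym (⌊log₂[2*b]⌋≡1+⌊log₂b⌋ m)) (*-monoʳ-≤ 2 ih)
    suc-double : ∀ m .{{_ : NonZero m}} → 2 ^ ⌊log₂ m ⌋ ≤ m → 2 ^ ⌊log₂ suc m ⌋ ≤ suc m →
                 2 ^ ⌊log₂ suc (2 * m) ⌋ ≤ suc (2 * m)
    suc-double m ih _ = subst (λ k → 2 ^ k ≤ suc (2 * m)) (sym (⌊log₂[1+2*n]⌋≡1+⌊log₂n⌋ m)) (m≤n⇒m≤1+n (*-monoʳ-≤ 2 ih))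

  n<2^[1+⌊log₂n⌋] : ∀ n → n < 2 ^ suc ⌊log₂ n ⌋
  n<2^[1+⌊log₂n⌋] zero = s≤s z≤n
  n<2^[1+⌊log₂n⌋] n@(suc _) = binary-induction (λ n → n < 2 ^ suc ⌊log₂ n ⌋) ≤-refl double suc-double n
    where
    double : ∀ m .{{_ : NonZero m}} → m < 2 ^ suc ⌊log₂ m ⌋ → 2 * m < 2 ^ suc ⌊log₂ (2 * m) ⌋
    double m ih = subst (λ k → 2 * m < 2 ^ suc k) (sym (⌊log₂[2*b]⌋≡1+⌊log₂b⌋ m)) (*-monoʳ-< 2 ih)
    suc-double : ∀ m .{{_ : NonZero m}} → m < 2 ^ suc ⌊log₂ m ⌋ → suc m < 2 ^ suc ⌊log₂ suc m ⌋ →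
                 suc (2 * m) < 2 ^ suc ⌊log₂ suc (2 * m) ⌋
    suc-double m ih _ = subst (λ k → suc (2 * m) < 2 ^ suc k) (sym (⌊log₂[1+2*n]⌋≡1+⌊log₂n⌋ m)) $
      ≤-trans (≤-reflexive (sym (*-suc 2 m))) (*-monoʳ-≤ 2 ih)

  ⌊log₂[1+n]⌋-cases : ∀ n → ⌊log₂ suc n ⌋ ≡ ⌊log₂ n ⌋ ⊎ (⌊log₂ suc n ⌋ ≡ suc ⌊log₂ n ⌋ × suc n ≡ 2 ^ ⌊log₂ suc n ⌋)
  ⌊log₂[1+n]⌋-cases n with m≤n⇒m<n∨m≡n (⌊log₂⌋-mono-≤ (n≤1+n n))
  ... | inj₂ L≡L′ = inj₁ (sym L≡L′)
  ... | inj₁ L<L′ = inj₂ (L′≡1+L , ≤-antisym 1+n≤2^L′ (2^⌊log₂n⌋≤n (suc n)))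
    where
    L′≤1+L : ⌊log₂ suc n ⌋ ≤ suc ⌊log₂ n ⌋
    L′≤1+L = ≤-trans (⌊log₂⌋-mono-≤ (n<2^[1+⌊log₂n⌋] n)) (≤-reflexive (⌊log₂[2^n]⌋≡n (suc ⌊log₂ n ⌋)))
    L′≡1+L : ⌊log₂ suc n ⌋ ≡ suc ⌊log₂ n ⌋
    L′≡1+L = ≤-antisym L′≤1+L L<L′
    1+n≤2^L′ : suc n ≤ 2 ^ ⌊log₂ suc n ⌋
    1+n≤2^L′ = subst (λ k → suc n ≤ 2 ^ k) (sym L′≡1+L) (n<2^[1+⌊log₂n⌋] n)


module Sawtooth where

  open import Data.Nat
  open import Data.Nat.Properties
  open import Data.Nat.DivMod
  open import Data.Nat.Logarithm
  open import Data.Nat.Solver using (module +-*-Solver)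
  open import Data.Product using (_×_; _,_)
  open import Data.Sum using (_⊎_; inj₁; inj₂)
  open import Relation.Binary.PropositionalEquality
  open import Relation.Nullary using (yes; no)
  open +-*-Solver
  open Halving

  distToEnds : ℕ → ℕ → ℕ
  distToEnds r d = r ⊓ (d ∸ r)

  ⊓-distrib-+-sameOrder : ∀ {a b c d} → (a ≤ c × b ≤ d) ⊎ (c ≤ a × d ≤ b) → (a + b) ⊓ (c + d) ≡ a ⊓ c + b ⊓ d
  ⊓-distrib-+-sameOrder (inj₁ (a≤c , b≤d)) =
    trans (m≤n⇒m⊓n≡m (+-mono-≤ a≤c b≤d)) (sym (cong₂ _+_ (m≤n⇒m⊓n≡m a≤c) (m≤n⇒m⊓n≡m b≤d)))
  ⊓-distrib-+-sameOrder (inj₂ (c≤a , d≤b)) =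
    trans (m≥n⇒m⊓n≡n (+-mono-≤ c≤a d≤b)) (sym (cong₂ _+_ (m≥n⇒m⊓n≡n c≤a) (m≥n⇒m⊓n≡n d≤b)))

  distToEnds-double : ∀ r d → distToEnds (2 * r) (2 * d) ≡ 2 * distToEnds r d
  distToEnds-double r d = trans (cong (2 * r ⊓_) (sym (*-distribˡ-∸ 2 d r))) (sym (*-distribˡ-⊓ 2 r (d ∸ r)))

  2*d∸[1+2*r]≡[d∸r]+[d∸[1+r]] : ∀ {r d} → r < d → 2 * d ∸ suc (2 * r) ≡ (d ∸ r) + (d ∸ suc r)
  2*d∸[1+2*r]≡[d∸r]+[d∸[1+r]] {r} {d} r<d =
    subst (λ d → 2 * d ∸ suc (2 * r) ≡ (d ∸ r) + (d ∸ suc r)) (m+[n∸m]≡n r<d) (split (d ∸ suc r))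
    where
    open ≤-Reasoning
    split : ∀ t → 2 * (suc r + t) ∸ suc (2 * r) ≡ (suc r + t ∸ r) + (suc r + t ∸ suc r)
    split t = begin-equality
      2 * (suc r + t) ∸ suc (2 * r)
        ≡⟨ cong (_∸ suc (2 * r)) (solve 2 (λ r t → con 2 :* (con 1 :+ r :+ t)
                                                := (con 1 :+ con 2 :* r) :+ (con 1 :+ con 2 :* t)) refl r t) ⟩
      suc (2 * r) + suc (2 * t) ∸ suc (2 * r)
        ≡⟨ m+n∸m≡n (suc (2 * r)) _ ⟩
      suc (2 * t)
        ≡⟨ solve 1 (λ t → con 1 :+ con 2 :* t := (con 1 :+ t) :+ t) refl t ⟩
      suc t + t
        ≡⟨ cong₂ _+_ (trans (cong (_∸ r) (sym (+-suc r t))) (m+n∸m≡n r (suc t))) (m+n∸m≡n (suc r) t) ⟨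
      (suc r + t ∸ r) + (suc r + t ∸ suc r)
        ∎

  -- The minimum splits over 1 + 2r = r + (1 + r) because r and 1 + r lie on the same side of
  -- d / 2 = e; this is where evenness of d is needed.
  distToEnds-suc-double : ∀ r e → r < 2 * e →
    distToEnds (suc (2 * r)) (2 * (2 * e)) ≡ distToEnds r (2 * e) + distToEnds (suc r) (2 * e)
  distToEnds-suc-double r e r<d = begin-equality
    suc (2 * r) ⊓ (2 * d ∸ suc (2 * r))
      ≡⟨ cong₂ _⊓_ (solve 1 (λ r → con 1 :+ con 2 :* r := r :+ (con 1 :+ r)) refl r) (2*d∸[1+2*r]≡[d∸r]+[d∸[1+r]] r<d) ⟩
    (r + suc r) ⊓ ((d ∸ r) + (d ∸ suc r))
      ≡⟨ ⊓-distrib-+-sameOrder sameOrder ⟩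
    distToEnds r d + distToEnds (suc r) d
      ∎
    where
    open ≤-Reasoning
    d = 2 * e
    2*e≡e+e : 2 * e ≡ e + e
    2*e≡e+e = cong (e +_) (+-identityʳ e)
    sameOrder : (r ≤ d ∸ r × suc r ≤ d ∸ suc r) ⊎ (d ∸ r ≤ r × d ∸ suc r ≤ suc r)
    sameOrder with r <? e
    ... | yes r<e = inj₁ (m+n≤o⇒m≤o∸n r (≤-trans (+-mono-≤ (<⇒≤ r<e) (<⇒≤ r<e)) (≤-reflexive (sym 2*e≡e+e)))
                       , m+n≤o⇒m≤o∸n (suc r) (≤-trans (+-mono-≤ r<e r<e) (≤-reflexive (sym 2*e≡e+e))))
    ... | no r≮e = inj₂ (m≤n+o⇒m∸n≤o d r (≤-trans (≤-reflexive 2*e≡e+e) (+-mono-≤ e≤r e≤r))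
                       , m≤n+o⇒m∸n≤o d (suc r) (≤-trans (≤-reflexive 2*e≡e+e) (+-mono-≤ (m≤n⇒m≤1+n e≤r) (m≤n⇒m≤1+n e≤r))))
      where e≤r = ≮⇒≥ r≮e

  %-unique : ∀ {m r} q d .{{_ : NonZero d}} → r < d → m ≡ r + q * d → m % d ≡ r
  %-unique {r = r} q d r<d refl = trans ([m+kn]%n≡m%n r q d) (m<n⇒m%n≡m r<d)

  distToEnds-[1+m]%d : ∀ m d .{{_ : NonZero d}} → distToEnds (suc m % d) d ≡ distToEnds (suc (m % d)) d
  distToEnds-[1+m]%d m d with m≤n⇒m<n∨m≡n (m%n<n m d)
  ... | inj₁ 1+r<d = cong (λ r → distToEnds r d) (%-unique (m / d) d 1+r<d (cong suc (m≡m%n+[m/n]*n m d)))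
  ... | inj₂ 1+r≡d = begin-equality
    distToEnds (suc m % d) d     ≡⟨ cong (λ r → distToEnds r d) (%-unique (suc (m / d)) d (>-nonZero⁻¹ d) m+1≡[1+q]*d) ⟩
    0                            ≡⟨ ⊓-zeroʳ (suc (m % d)) ⟨
    suc (m % d) ⊓ 0              ≡⟨ cong (suc (m % d) ⊓_) (trans (cong (d ∸_) 1+r≡d) (n∸n≡0 d)) ⟨
    distToEnds (suc (m % d)) d   ∎
    where
    open ≤-Reasoning
    m+1≡[1+q]*d : suc m ≡ 0 + suc (m / d) * d
    m+1≡[1+q]*d = trans (cong suc (m≡m%n+[m/n]*n m d)) (cong (_+ m / d * d) 1+r≡d)

  _%2^_ : ℕ → ℕ → ℕ
  n %2^ k = (n % 2 ^ k) {{m^n≢0 2 k}}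

  %2^-< : ∀ n k → n %2^ k < 2 ^ k
  %2^-< n k = m%n<n n (2 ^ k) {{m^n≢0 2 k}}

  2*m≡2*[m%2^k]+[m/2^k]*2^[1+k] : ∀ m k → 2 * m ≡ 2 * (m %2^ k) + (m / 2 ^ k) {{m^n≢0 2 k}} * 2 ^ suc k
  2*m≡2*[m%2^k]+[m/2^k]*2^[1+k] m k = begin-equality
    2 * m                  ≡⟨ cong (2 *_) (m≡m%n+[m/n]*n m (2 ^ k)) ⟩
    2 * (r + q * 2 ^ k)    ≡⟨ solve 3 (λ r q p → con 2 :* (r :+ q :* p) := con 2 :* r :+ q :* (con 2 :* p)) refl r q (2 ^ k) ⟩
    2 * r + q * 2 ^ suc k  ∎
    where
    open ≤-Reasoning
    instance _ = m^n≢0 2 k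
    r = m % 2 ^ k
    q = m / 2 ^ k

  [2*m]%2^[1+k] : ∀ m k → (2 * m) %2^ suc k ≡ 2 * (m %2^ k)
  [2*m]%2^[1+k] m k = %-unique ((m / 2 ^ k) {{m^n≢0 2 k}}) (2 ^ suc k) {{m^n≢0 2 (suc k)}}
    (*-monoʳ-< 2 (%2^-< m k)) (2*m≡2*[m%2^k]+[m/2^k]*2^[1+k] m k)

  [1+2*m]%2^[1+k] : ∀ m k → suc (2 * m) %2^ suc k ≡ suc (2 * (m %2^ k))
  [1+2*m]%2^[1+k] m k = %-unique ((m / 2 ^ k) {{m^n≢0 2 k}}) (2 ^ suc k) {{m^n≢0 2 (suc k)}}
    1+2r<2^[1+k] (cong suc (2*m≡2*[m%2^k]+[m/2^k]*2^[1+k] m k))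
    where
    1+2r<2^[1+k] : suc (2 * (m %2^ k)) < 2 ^ suc k
    1+2r<2^[1+k] = ≤-trans (≤-reflexive (sym (*-suc 2 (m %2^ k)))) (*-monoʳ-≤ 2 (%2^-< m k))

  -- sawtooth n k is 2^k · Zigzag(n / 2^k); see ℕ→ℚ[2^k]*Zigzag[n/2^k].
  sawtooth : ℕ → ℕ → ℕ
  sawtooth n k = distToEnds (n %2^ k) (2 ^ k)

  sawtooth-double : ∀ m k → sawtooth (2 * m) (suc k) ≡ 2 * sawtooth m k
  sawtooth-double m k = trans (cong (λ r → distToEnds r (2 ^ suc k)) ([2*m]%2^[1+k] m k)) (distToEnds-double (m %2^ k) (2 ^ k))

  sawtooth-[2*m]-1 : ∀ m → sawtooth (2 * m) 1 ≡ 0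
  sawtooth-[2*m]-1 m = trans (sawtooth-double m 0) (cong (λ r → 2 * distToEnds r 1) (n%1≡0 m))

  sawtooth-[1+2*m]-1 : ∀ m → sawtooth (suc (2 * m)) 1 ≡ 1
  sawtooth-[1+2*m]-1 m = cong (λ r → distToEnds r 2) (trans ([1+2*m]%2^[1+k] m 0) (cong (λ r → suc (2 * r)) (n%1≡0 m)))

  sawtooth-suc-double : ∀ m k → sawtooth (suc (2 * m)) (suc (suc k)) ≡ sawtooth m (suc k) + sawtooth (suc m) (suc k)
  sawtooth-suc-double m k = begin-equality
    distToEnds (suc (2 * m) %2^ suc (suc k)) (2 * p)   ≡⟨ cong (λ r → distToEnds r (2 * p)) ([1+2*m]%2^[1+k] m (suc k)) ⟩
    distToEnds (suc (2 * r)) (2 * p)                   ≡⟨ distToEnds-suc-double r (2 ^ k) (%2^-< m (suc k)) ⟩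
    distToEnds r p + distToEnds (suc r) p              ≡⟨ cong (distToEnds r p +_) (distToEnds-[1+m]%d m p {{m^n≢0 2 (suc k)}}) ⟨
    sawtooth m (suc k) + sawtooth (suc m) (suc k)      ∎
    where
    open ≤-Reasoning
    p = 2 ^ suc k
    r = m %2^ suc k

  sawtooth-2^k : ∀ k → sawtooth (2 ^ k) k ≡ 0
  sawtooth-2^k k = cong (λ r → distToEnds r (2 ^ k)) (n%n≡0 (2 ^ k) {{m^n≢0 2 k}})

  sawtoothSum : ℕ → ℕ → ℕ
  sawtoothSum n zero = 0
  sawtoothSum n (suc k) = sawtoothSum n k + sawtooth n (suc k)

  sawtoothSum-double : ∀ m K → sawtoothSum (2 * m) (suc K) ≡ 2 * sawtoothSum m K
  sawtoothSum-double m zero = sawtooth-[2*m]-1 m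
  sawtoothSum-double m (suc K) = trans (cong₂ _+_ (sawtoothSum-double m K) (sawtooth-double m (suc K)))
                                       (sym (*-distribˡ-+ 2 (sawtoothSum m K) _))

  sawtoothSum-suc-double : ∀ m K → sawtoothSum (suc (2 * m)) (suc K) ≡ suc (sawtoothSum m K + sawtoothSum (suc m) K)
  sawtoothSum-suc-double m zero = sawtooth-[1+2*m]-1 m
  sawtoothSum-suc-double m (suc K) = begin-equality
    sawtoothSum (suc (2 * m)) (suc K) + sawtooth (suc (2 * m)) (suc (suc K))
      ≡⟨ cong₂ _+_ (sawtoothSum-suc-double m K) (sawtooth-suc-double m K) ⟩
    suc (a + b) + (c + d)
      ≡⟨ cong suc (solve 4 (λ a b c d → (a :+ b) :+ (c :+ d) := (a :+ c) :+ (b :+ d)) refl a b c d) ⟩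
    suc (sawtoothSum m (suc K) + sawtoothSum (suc m) (suc K)) ∎
    where
    open ≤-Reasoning
    a = sawtoothSum m K
    b = sawtoothSum (suc m) K
    c = sawtooth m (suc K)
    d = sawtooth (suc m) (suc K)

  Fℕ : ℕ → ℕ
  Fℕ n = sawtoothSum n ⌊log₂ n ⌋

  -- ⌊log₂ (1 + m)⌋ exceeds ⌊log₂ m⌋ only when 1 + m is a power of two, and then the extra
  -- summand vanishes.
  sawtoothSum-[1+m]-⌊log₂m⌋ : ∀ m → sawtoothSum (suc m) ⌊log₂ m ⌋ ≡ Fℕ (suc m)
  sawtoothSum-[1+m]-⌊log₂m⌋ m with ⌊log₂[1+n]⌋-cases m
  ... | inj₁ L′≡L = cong (sawtoothSum (suc m)) (sym L′≡L)
  ... | inj₂ (L′≡1+L , 1+m≡2^L′) = begin-equality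
    sawtoothSum (suc m) L                          ≡⟨ +-identityʳ _ ⟨
    sawtoothSum (suc m) L + 0                      ≡⟨ cong (sawtoothSum (suc m) L +_) (top-term-vanishes) ⟨
    sawtoothSum (suc m) (suc L)                    ≡⟨ cong (sawtoothSum (suc m)) L′≡1+L ⟨
    Fℕ (suc m)                                     ∎
    where
    open ≤-Reasoning
    L = ⌊log₂ m ⌋
    top-term-vanishes : sawtooth (suc m) (suc L) ≡ 0
    top-term-vanishes = subst (λ n → sawtooth n (suc L) ≡ 0) (sym (trans 1+m≡2^L′ (cong (2 ^_) L′≡1+L))) (sawtooth-2^k (suc L))

  Fℕ-double : ∀ m .{{_ : NonZero m}} → Fℕ (2 * m) ≡ 2 * Fℕ m
  Fℕ-double m = trans (cong (sawtoothSum (2 * m)) (⌊log₂[2*b]⌋≡1+⌊log₂b⌋ m)) (sawtoothSum-double m ⌊log₂ m ⌋)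

  Fℕ-suc-double : ∀ m .{{_ : NonZero m}} → Fℕ (suc (2 * m)) ≡ suc (Fℕ m + Fℕ (suc m))
  Fℕ-suc-double m = begin-equality
    Fℕ (suc (2 * m))                                           ≡⟨ cong (sawtoothSum (suc (2 * m))) (⌊log₂[1+2*n]⌋≡1+⌊log₂n⌋ m) ⟩
    sawtoothSum (suc (2 * m)) (suc ⌊log₂ m ⌋)                  ≡⟨ sawtoothSum-suc-double m ⌊log₂ m ⌋ ⟩
    suc (Fℕ m + sawtoothSum (suc m) ⌊log₂ m ⌋)                 ≡⟨ cong (λ x → suc (Fℕ m + x)) (sawtoothSum-[1+m]-⌊log₂m⌋ m) ⟩
    suc (Fℕ m + Fℕ (suc m))                                    ∎
    where open ≤-Reasoning


module MergeSort where

  open import Data.Nat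
  open import Data.Nat.Properties
  open import Data.Nat.Logarithm
  open import Data.Nat.Solver using (module +-*-Solver)
  open import Relation.Binary.PropositionalEquality
  open +-*-Solver
  open Halving
  open Sawtooth using (Fℕ; Fℕ-double; Fℕ-suc-double)

  Bfuel-irrelevant : ∀ {f g} n .{{_ : NonZero n}} → n ≤ f → n ≤ g → Bfuel f n ≡ Bfuel g n
  Bfuel-irrelevant {suc f} {suc g} 1 _ _ = refl
  Bfuel-irrelevant {suc f} {suc g} n@(suc (suc k)) n≤f n≤g =
    cong₂ (λ a b → ⌊ n /2⌋ + a + b) (Bfuel-irrelevant ⌊ n /2⌋ (≤-trans ⌊n/2⌋≤⌈n/2⌉′ ⌈n/2⌉≤f) (≤-trans ⌊n/2⌋≤⌈n/2⌉′ ⌈n/2⌉≤g))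
                                    (Bfuel-irrelevant ⌈ n /2⌉ ⌈n/2⌉≤f ⌈n/2⌉≤g)
    where
    ⌊n/2⌋≤⌈n/2⌉′ = ⌊n/2⌋≤⌈n/2⌉ n
    ⌈n/2⌉≤f = s≤s⁻¹ (≤-trans (⌈n/2⌉<n k) n≤f)
    ⌈n/2⌉≤g = s≤s⁻¹ (≤-trans (⌈n/2⌉<n k) n≤g)

  B-rec : ∀ n → 2 ≤ n → B n ≡ ⌊ n /2⌋ + B ⌊ n /2⌋ + B ⌈ n /2⌉
  B-rec 1 (s≤s ())
  B-rec n@(suc (suc k)) _ = cong₂ (λ a b → ⌊ n /2⌋ + a + b)
    (Bfuel-irrelevant ⌊ n /2⌋ (≤-trans (⌊n/2⌋≤⌈n/2⌉ n) ⌈n/2⌉≤1+k) ≤-refl)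
    (Bfuel-irrelevant ⌈ n /2⌉ ⌈n/2⌉≤1+k ≤-refl)
    where
    ⌈n/2⌉≤1+k : ⌈ n /2⌉ ≤ suc k
    ⌈n/2⌉≤1+k = s≤s⁻¹ (⌈n/2⌉<n k)

  B-double : ∀ m .{{_ : NonZero m}} → B (2 * m) ≡ m + B m + B m
  B-double m = trans (B-rec (2 * m) (*-monoʳ-≤ 2 (>-nonZero⁻¹ m)))
                     (cong₂ (λ a b → a + B a + B b) (⌊2*n/2⌋≡n m) (trans (cong ⌈_/2⌉ 2*m≡m+m) (sym (n≡⌈n+n/2⌉ m))))
    where
    2*m≡m+m : 2 * m ≡ m + m
    2*m≡m+m = cong (m +_) (+-identityʳ m)

  B-suc-double : ∀ m .{{_ : NonZero m}} → B (suc (2 * m)) ≡ m + B m + B (suc m)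
  B-suc-double m = trans (B-rec (suc (2 * m)) (s≤s (<-≤-trans (>-nonZero⁻¹ m) (m≤m+n m _))))
                         (cong₂ (λ a b → a + B a + B b) (⌊[1+2*n]/2⌋≡n m) (cong suc (⌊2*n/2⌋≡n m)))

  W-double : ∀ m .{{_ : NonZero m}} → W (2 * m) + 1 ≡ W m + W m + 2 * m
  W-double 1 = refl
  W-double (suc m@(suc _)) = begin-equality
    W (2 * suc m) + 1
      ≡⟨ cong (λ n → W n + 1) (*-suc 2 m) ⟩
    W (2 * m) + ⌈log₂ suc (2 * m) ⌉ + ⌈log₂ 2 + 2 * m ⌉ + 1
      ≡⟨ cong₂ (λ a b → W (2 * m) + a + b + 1) (⌈log₂[1+2*n]⌉≡1+⌈log₂[1+n]⌉ m) ⌈log₂[2+2*m]⌉≡1+c ⟩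
    W (2 * m) + suc c + suc c + 1
      ≡⟨ solve 2 (λ w c → w :+ (con 1 :+ c) :+ (con 1 :+ c) :+ con 1 := (w :+ con 1) :+ (con 2 :+ con 2 :* c)) refl (W (2 * m)) c ⟩
    (W (2 * m) + 1) + (2 + 2 * c)
      ≡⟨ cong (_+ (2 + 2 * c)) (W-double m) ⟩
    (W m + W m + 2 * m) + (2 + 2 * c)
      ≡⟨ solve 3 (λ w c m → (w :+ w :+ con 2 :* m) :+ (con 2 :+ con 2 :* c)
                          := (w :+ c) :+ (w :+ c) :+ con 2 :* (con 1 :+ m)) refl (W m) c m ⟩
    W (suc m) + W (suc m) + 2 * suc m
      ∎
    where
    open ≤-Reasoning
    c = ⌈log₂ suc m ⌉
    ⌈log₂[2+2*m]⌉≡1+c : ⌈log₂ 2 + 2 * m ⌉ ≡ suc c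
    ⌈log₂[2+2*m]⌉≡1+c = trans (cong ⌈log₂_⌉ (sym (*-suc 2 m))) (⌈log₂2*n⌉≡1+⌈log₂n⌉ (suc m))

  W-suc-double : ∀ m .{{_ : NonZero m}} → W (suc (2 * m)) + 1 ≡ W m + W (suc m) + 2 * m + 1
  W-suc-double m = begin-equality
    W (2 * m) + ⌈log₂ suc (2 * m) ⌉ + 1
      ≡⟨ cong (λ c → W (2 * m) + c + 1) (⌈log₂[1+2*n]⌉≡1+⌈log₂[1+n]⌉ m) ⟩
    W (2 * m) + suc c + 1
      ≡⟨ solve 2 (λ w c → w :+ (con 1 :+ c) :+ con 1 := (w :+ con 1) :+ (con 1 :+ c)) refl (W (2 * m)) c ⟩
    (W (2 * m) + 1) + suc c
      ≡⟨ cong (_+ suc c) (W-double m) ⟩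
    W m + W m + 2 * m + suc c
      ≡⟨ solve 3 (λ w c m → w :+ w :+ con 2 :* m :+ (con 1 :+ c) := w :+ (w :+ c) :+ con 2 :* m :+ con 1) refl (W m) c m ⟩
    W m + W (suc m) + 2 * m + 1
      ∎
    where
    open ≤-Reasoning
    c = ⌈log₂ suc m ⌉

  2*B+Fℕ+1≡W+n : ∀ n .{{_ : NonZero n}} → 2 * B n + Fℕ n + 1 ≡ W n + n
  2*B+Fℕ+1≡W+n = binary-induction (λ n → 2 * B n + Fℕ n + 1 ≡ W n + n) refl double suc-double
    where
    open ≤-Reasoning
    double : ∀ m .{{_ : NonZero m}} → 2 * B m + Fℕ m + 1 ≡ W m + m → 2 * B (2 * m) + Fℕ (2 * m) + 1 ≡ W (2 * m) + 2 * m
    double m ih = +-cancelʳ-≡ 1 _ _ (begin-equality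
      2 * B (2 * m) + Fℕ (2 * m) + 1 + 1
        ≡⟨ cong₂ (λ b f → 2 * b + f + 1 + 1) (B-double m) (Fℕ-double m) ⟩
      2 * (m + B m + B m) + 2 * Fℕ m + 1 + 1
        ≡⟨ solve 3 (λ m b f → con 2 :* (m :+ b :+ b) :+ con 2 :* f :+ con 1 :+ con 1
                            := con 2 :* m :+ con 2 :* (con 2 :* b :+ f :+ con 1)) refl m (B m) (Fℕ m) ⟩
      2 * m + 2 * (2 * B m + Fℕ m + 1)
        ≡⟨ cong (λ x → 2 * m + 2 * x) ih ⟩
      2 * m + 2 * (W m + m)
        ≡⟨ solve 2 (λ m w → con 2 :* m :+ con 2 :* (w :+ m) := (w :+ w :+ con 2 :* m) :+ con 2 :* m) refl m (W m) ⟩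
      (W m + W m + 2 * m) + 2 * m
        ≡⟨ cong (_+ 2 * m) (W-double m) ⟨
      W (2 * m) + 1 + 2 * m
        ≡⟨ solve 2 (λ w n → w :+ con 1 :+ n := w :+ n :+ con 1) refl (W (2 * m)) (2 * m) ⟩
      W (2 * m) + 2 * m + 1
        ∎)
    suc-double : ∀ m .{{_ : NonZero m}} → 2 * B m + Fℕ m + 1 ≡ W m + m → 2 * B (suc m) + Fℕ (suc m) + 1 ≡ W (suc m) + suc m →
                 2 * B (suc (2 * m)) + Fℕ (suc (2 * m)) + 1 ≡ W (suc (2 * m)) + suc (2 * m)
    suc-double m ih ih′ = +-cancelʳ-≡ 1 _ _ (begin-equality
      2 * B n + Fℕ n + 1 + 1
        ≡⟨ cong₂ (λ b f → 2 * b + f + 1 + 1) (B-suc-double m) (Fℕ-suc-double m) ⟩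
      2 * (m + B m + B (suc m)) + suc (Fℕ m + Fℕ (suc m)) + 1 + 1
        ≡⟨ solve 5 (λ m b b′ f f′ → con 2 :* (m :+ b :+ b′) :+ (con 1 :+ (f :+ f′)) :+ con 1 :+ con 1
                                  := con 2 :* m :+ (con 2 :* b :+ f :+ con 1) :+ (con 2 :* b′ :+ f′ :+ con 1) :+ con 1)
                 refl m (B m) (B (suc m)) (Fℕ m) (Fℕ (suc m)) ⟩
      2 * m + (2 * B m + Fℕ m + 1) + (2 * B (suc m) + Fℕ (suc m) + 1) + 1
        ≡⟨ cong₂ (λ x y → 2 * m + x + y + 1) ih ih′ ⟩
      2 * m + (W m + m) + (W (suc m) + suc m) + 1
        ≡⟨ solve 3 (λ m w w′ → con 2 :* m :+ (w :+ m) :+ (w′ :+ (con 1 :+ m)) :+ con 1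
                             := (w :+ w′ :+ con 2 :* m :+ con 1) :+ (con 1 :+ con 2 :* m))
                 refl m (W m) (W (suc m)) ⟩
      (W m + W (suc m) + 2 * m + 1) + n
        ≡⟨ cong (_+ n) (W-suc-double m) ⟨
      W n + 1 + n
        ≡⟨ solve 2 (λ w n → w :+ con 1 :+ n := w :+ n :+ con 1) refl (W n) n ⟩
      W n + n + 1 ∎)
      where n = suc (2 * m)

import Algebra.Properties.Group
open import Data.Empty using (⊥-elim)
open import Data.Integer as ℤ using (ℤ; +_; -[1+_]; +0; +[1+_])
open import Data.Integer.DivMod using (_/ℕ_; _%ℕ_; a≡a%ℕn+[a/ℕn]*n; n%ℕd<d; div-pos-is-/ℕ)
open import Data.Integer.GCD using (gcd)
import Data.Integer.Properties as ℤₚ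
open import Data.Integer.Solver using (module +-*-Solver)
open import Data.Nat as ℕ using (ℕ; zero; suc; NonZero; _^_)
open import Data.Nat.Coprimality as Coprime using (1-coprimeTo)
open import Data.Nat.Logarithm using (⌊log₂_⌋)
import Data.Nat.Properties as ℕₚ
open import Data.Rational as ℚ using (ℚ; mkℚ; floor; ceiling; _/_; _+_; _*_; _-_; -_; _⊓_)
import Data.Rational.Properties as ℚₚ
import Data.Rational.Solver
open import Data.Rational.Unnormalised using (mkℚᵘ; *≡*)
open import Data.Sum using (inj₁; inj₂)
open import Relation.Binary.Definitions using (tri<; tri≈; tri>)
open import Relation.Binary.PropositionalEquality
open Algebra.Properties.Group ℚₚ.+-0-group using (⁻¹-involutive)
open Sawtooth using (distToEnds; sawtooth; sawtoothSum; Fℕ)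
open MergeSort using (2*B+Fℕ+1≡W+n)

fromℤ : ℤ → ℚ
fromℤ i = i / 1

fromℤ≡mkℚ : ∀ i → fromℤ i ≡ mkℚ i 0 (Coprime.sym (1-coprimeTo ℤ.∣ i ∣))
fromℤ≡mkℚ i = ℚₚ.↥p/↧p≡p (mkℚ i 0 _)

fromℤ-homo-+ : ∀ i j → fromℤ (i ℤ.+ j) ≡ fromℤ i + fromℤ j
fromℤ-homo-+ i j = sym (trans (cong₂ _+_ (fromℤ≡mkℚ i) (fromℤ≡mkℚ j))
                              (cong fromℤ (cong₂ ℤ._+_ (ℤₚ.*-identityʳ i) (ℤₚ.*-identityʳ j))))

fromℤ-homo-* : ∀ i j → fromℤ (i ℤ.* j) ≡ fromℤ i * fromℤ j
fromℤ-homo-* i j = sym (cong₂ _*_ (fromℤ≡mkℚ i) (fromℤ≡mkℚ j))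

fromℤ-homo-neg : ∀ i → fromℤ (ℤ.- i) ≡ - fromℤ i
fromℤ-homo-neg +0 = refl
fromℤ-homo-neg +[1+ n ] = refl
fromℤ-homo-neg -[1+ n ] = sym (⁻¹-involutive (fromℤ +[1+ n ]))

fromℤ-homo-- : ∀ i j → fromℤ (i ℤ.- j) ≡ fromℤ i - fromℤ j
fromℤ-homo-- i j = trans (fromℤ-homo-+ i (ℤ.- j)) (cong (λ q → fromℤ i + q) (fromℤ-homo-neg j))

ℕ→ℚ-homo-+ : ∀ m n → ℕ→ℚ (m ℕ.+ n) ≡ ℕ→ℚ m + ℕ→ℚ n
ℕ→ℚ-homo-+ m n = fromℤ-homo-+ (+ m) (+ n)

ℕ→ℚ-homo-* : ∀ m n → ℕ→ℚ (m ℕ.* n) ≡ ℕ→ℚ m * ℕ→ℚ n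
ℕ→ℚ-homo-* m n = trans (cong fromℤ (ℤₚ.pos-* m n)) (fromℤ-homo-* (+ m) (+ n))

ℕ→ℚ-mono-≤ : ∀ {m n} → m ℕ.≤ n → ℕ→ℚ m ℚ.≤ ℕ→ℚ n
ℕ→ℚ-mono-≤ {m} {n} m≤n rewrite fromℤ≡mkℚ (+ m) | fromℤ≡mkℚ (+ n) = ℚ.*≤* (ℤₚ.*-monoʳ-≤-nonNeg (+ 1) (ℤ.+≤+ m≤n))

ℕ→ℚ-homo-⊓ : ∀ m n → ℕ→ℚ (m ℕ.⊓ n) ≡ ℕ→ℚ m ⊓ ℕ→ℚ n
ℕ→ℚ-homo-⊓ m n with ℕₚ.≤-total m n
... | inj₁ m≤n = trans (cong ℕ→ℚ (ℕₚ.m≤n⇒m⊓n≡m m≤n)) (sym (ℚₚ.p≤q⇒p⊓q≡p (ℕ→ℚ-mono-≤ m≤n)))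
... | inj₂ n≤m = trans (cong ℕ→ℚ (ℕₚ.m≥n⇒m⊓n≡n n≤m)) (sym (ℚₚ.p≥q⇒p⊓q≡q (ℕ→ℚ-mono-≤ n≤m)))

ceiling≡-floor-neg : ∀ p → ceiling p ≡ ℤ.- floor (- p)
ceiling≡-floor-neg (mkℚ _ _ _) = refl

/-cross : ∀ i j d e → i ℤ.* + suc e ≡ j ℤ.* + suc d → i / suc d ≡ j / suc e
/-cross i j d e eq = ℚₚ.fromℚᵘ-cong {mkℚᵘ i d} {mkℚᵘ j e} (*≡* eq)

fromℤ[d]*[i/d]≡fromℤ[i] : ∀ i d .{{_ : NonZero d}} → fromℤ (+ d) * (i / d) ≡ fromℤ i
fromℤ[d]*[i/d]≡fromℤ[i] i d rewrite fromℤ≡mkℚ (+ d) with i / d | ℚₚ.↥-/ i d | ℚₚ.↧-/ i d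
... | mkℚ a b-1 _ | a*g≡i | b*g≡d = /-cross (+ d ℤ.* a) i (b-1 ℕ.+ 0) 0 (begin
  + d ℤ.* a ℤ.* + 1               ≡⟨ ℤₚ.*-identityʳ _ ⟩
  + d ℤ.* a                        ≡⟨ cong (ℤ._* a) b*g≡d ⟨
  + suc b-1 ℤ.* g ℤ.* a            ≡⟨ solve 3 (λ b g a → b :* g :* a := a :* g :* b) refl (+ suc b-1) g a ⟩
  a ℤ.* g ℤ.* + suc b-1            ≡⟨ cong₂ ℤ._*_ a*g≡i (cong +_ (sym (ℕₚ.+-identityʳ (suc b-1)))) ⟩
  i ℤ.* + (suc b-1 ℕ.+ 0)          ∎)
  where
  open ≡-Reasoning
  open +-*-Solver
  g = gcd i (+ d)

r+qd<r′+q′d : ∀ {q q′ r r′ d} → r ℕ.< d → q ℤ.< q′ → + r ℤ.+ q ℤ.* + d ℤ.< + r′ ℤ.+ q′ ℤ.* + d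
r+qd<r′+q′d {q} {q′} {r} {r′} {d} r<d q<q′ = begin-strict
  + r ℤ.+ q ℤ.* + d    <⟨ ℤₚ.+-monoˡ-< (q ℤ.* + d) (ℤ.+<+ r<d) ⟩
  + d ℤ.+ q ℤ.* + d    ≡⟨ ℤₚ.suc-* q (+ d) ⟨
  ℤ.suc q ℤ.* + d      ≤⟨ ℤₚ.*-monoʳ-≤-nonNeg (+ d) (ℤₚ.i<j⇒suc[i]≤j q<q′) ⟩
  q′ ℤ.* + d           ≤⟨ ℤₚ.i≤j+i _ (+ r′) ⟩
  + r′ ℤ.+ q′ ℤ.* + d  ∎
  where open ℤₚ.≤-Reasoning

/ℕ-unique : ∀ {i r} q d .{{_ : NonZero d}} → r ℕ.< d → i ≡ + r ℤ.+ q ℤ.* + d → i /ℕ d ≡ q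
/ℕ-unique {i} {r} q d r<d i≡r+qd with ℤₚ.<-cmp (i /ℕ d) q
... | tri≈ _ q₀≡q _ = q₀≡q
... | tri< q₀<q _ _ = ⊥-elim (ℤₚ.<-irrefl i₀≡i (r+qd<r′+q′d (n%ℕd<d i d) q₀<q))
  where i₀≡i = trans (sym (a≡a%ℕn+[a/ℕn]*n i d)) i≡r+qd
... | tri> _ _ q<q₀ = ⊥-elim (ℤₚ.<-irrefl i≡i₀ (r+qd<r′+q′d r<d q<q₀))
  where i≡i₀ = trans (sym i≡r+qd) (a≡a%ℕn+[a/ℕn]*n i d)

floor-/ : ∀ i d .{{_ : NonZero d}} → floor (i / d) ≡ i /ℕ d
floor-/ i d with i / d | ℚₚ.↥-/ i d | ℚₚ.↧-/ i d
... | mkℚ a b-1 _ | a*g≡i | b*g≡d = begin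
  a ℤ./ + b    ≡⟨ div-pos-is-/ℕ a b ⟩
  a /ℕ b       ≡⟨ /ℕ-unique (a /ℕ b) d r′g<d i≡r′g+q′d ⟨
  i /ℕ d       ∎
  where
  open ≡-Reasoning
  open +-*-Solver
  b = suc b-1
  g = ℤ.∣ gcd i (+ d) ∣
  r′ = a %ℕ b
  q′ = a /ℕ b
  bg≡d : b ℕ.* g ≡ d
  bg≡d = ℤₚ.+-injective (trans (ℤₚ.pos-* b g) b*g≡d)
  instance
    g≢0 : NonZero g
    g≢0 = ℕ.≢-nonZero λ g≡0 → ℕ.≢-nonZero⁻¹ d (trans (sym bg≡d) (trans (cong (b ℕ.*_) g≡0) (ℕₚ.*-zeroʳ b)))
  r′g<d : r′ ℕ.* g ℕ.< d
  r′g<d = subst (r′ ℕ.* g ℕ.<_) bg≡d (ℕₚ.*-monoˡ-< g (n%ℕd<d a b))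
  i≡r′g+q′d : i ≡ + (r′ ℕ.* g) ℤ.+ q′ ℤ.* + d
  i≡r′g+q′d = begin
    i                                        ≡⟨ a*g≡i ⟨
    a ℤ.* + g                                ≡⟨ cong (ℤ._* + g) (a≡a%ℕn+[a/ℕn]*n a b) ⟩
    (+ r′ ℤ.+ q′ ℤ.* + b) ℤ.* + g
      ≡⟨ solve 4 (λ r q b g → (r :+ q :* b) :* g := r :* g :+ q :* (b :* g)) refl (+ r′) q′ (+ b) (+ g) ⟩
    + r′ ℤ.* + g ℤ.+ q′ ℤ.* (+ b ℤ.* + g)    ≡⟨ cong₂ (λ x y → x ℤ.+ q′ ℤ.* y) (sym (ℤₚ.pos-* r′ g)) b*g≡d ⟩
    + (r′ ℕ.* g) ℤ.+ q′ ℤ.* + d              ∎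

neg-/ : ∀ i d .{{_ : NonZero d}} → - (i / d) ≡ (ℤ.- i) / d
neg-/ +0       d = trans (cong -_ (ℚₚ.0/n≡0 d)) (sym (ℚₚ.0/n≡0 d))
neg-/ +[1+ n ] d = refl
neg-/ -[1+ n ] d = ⁻¹-involutive (+[1+ n ] / d)

*-distribˡ-- : ∀ p q r → p * (q - r) ≡ p * q - p * r
*-distribˡ-- p q r = trans (ℚₚ.*-distribˡ-+ p q (- r)) (cong (λ s → p * q + s) (sym (ℚₚ.neg-distribʳ-* p r)))

ℕ→ℚ[d]*frac[i/d]≡i%d : ∀ i d .{{_ : NonZero d}} → ℕ→ℚ d * (i / d - fromℤ (floor (i / d))) ≡ ℕ→ℚ (i %ℕ d)
ℕ→ℚ[d]*frac[i/d]≡i%d i d = begin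
  D * (x - fromℤ (floor x))              ≡⟨ cong (λ q → D * (x - fromℤ q)) (floor-/ i d) ⟩
  D * (x - fromℤ q)                      ≡⟨ *-distribˡ-- D x (fromℤ q) ⟩
  D * x - D * fromℤ q                    ≡⟨ cong₂ _-_ (fromℤ[d]*[i/d]≡fromℤ[i] i d) (sym (fromℤ-homo-* (+ d) q)) ⟩
  fromℤ i - fromℤ (+ d ℤ.* q)            ≡⟨ fromℤ-homo-- i (+ d ℤ.* q) ⟨
  fromℤ (i ℤ.- + d ℤ.* q)                ≡⟨ cong fromℤ i-dq≡r ⟩
  ℕ→ℚ (i %ℕ d)                           ∎
  where
  open ≡-Reasoning
  D = ℕ→ℚ d
  x = i / d
  q = i /ℕ d
  i-dq≡r : i ℤ.- + d ℤ.* q ≡ + (i %ℕ d)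
  i-dq≡r = begin
    i ℤ.- + d ℤ.* q                               ≡⟨ cong (ℤ._- + d ℤ.* q) (a≡a%ℕn+[a/ℕn]*n i d) ⟩
    (+ (i %ℕ d) ℤ.+ q ℤ.* + d) ℤ.- + d ℤ.* q      ≡⟨ solve 3 (λ r q d → (r :+ q :* d) :- d :* q := r) refl (+ (i %ℕ d)) q (+ d) ⟩
    + (i %ℕ d)                                    ∎
    where open +-*-Solver

ℕ→ℚ[d]*Zigzag[i/d] : ∀ i d .{{_ : NonZero d}} → ℕ→ℚ d * Zigzag (i / d) ≡ ℕ→ℚ (i %ℕ d ℕ.⊓ ((ℤ.- i) %ℕ d))
ℕ→ℚ[d]*Zigzag[i/d] i d = begin
  D * ((x - fromℤ (floor x)) ⊓ (fromℤ (ceiling x) - x))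
    ≡⟨ ℚₚ.*-distribˡ-⊓-nonNeg D {{ℚₚ.normalize-nonNeg d 1}} _ _ ⟩
  (D * (x - fromℤ (floor x))) ⊓ (D * (fromℤ (ceiling x) - x))
    ≡⟨ cong (λ y → (D * (x - fromℤ (floor x))) ⊓ (D * y)) ceiling-side ⟩
  (D * (x - fromℤ (floor x))) ⊓ (D * (x′ - fromℤ (floor x′)))
    ≡⟨ cong₂ _⊓_ (ℕ→ℚ[d]*frac[i/d]≡i%d i d) (ℕ→ℚ[d]*frac[i/d]≡i%d (ℤ.- i) d) ⟩
  ℕ→ℚ (i %ℕ d) ⊓ ℕ→ℚ ((ℤ.- i) %ℕ d)
    ≡⟨ ℕ→ℚ-homo-⊓ (i %ℕ d) _ ⟨
  ℕ→ℚ (i %ℕ d ℕ.⊓ ((ℤ.- i) %ℕ d))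
    ∎
  where
  open ≡-Reasoning
  D = ℕ→ℚ d
  x = i / d
  x′ = (ℤ.- i) / d
  ceiling-side : fromℤ (ceiling x) - x ≡ x′ - fromℤ (floor x′)
  ceiling-side = begin
    fromℤ (ceiling x) - x                ≡⟨ cong (λ c → fromℤ c - x) (ceiling≡-floor-neg x) ⟩
    fromℤ (ℤ.- floor (- x)) - x          ≡⟨ cong (_- x) (fromℤ-homo-neg (floor (- x))) ⟩
    - fromℤ (floor (- x)) - x            ≡⟨ ℚₚ.+-comm (- fromℤ (floor (- x))) (- x) ⟩
    - x - fromℤ (floor (- x))            ≡⟨ cong (λ y → y - fromℤ (floor y)) (neg-/ i d) ⟩
    x′ - fromℤ (floor x′)                ∎

-- (ℤ.- + n) %ℕ d is d ∸ n % d, except that it is 0 rather than d when d divides n.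
[+n%d]⊓[-n%d]≡distToEnds : ∀ n d .{{_ : NonZero d}} → (+ n %ℕ d) ℕ.⊓ ((ℤ.- + n) %ℕ d) ≡ distToEnds (n ℕ.% d) d
[+n%d]⊓[-n%d]≡distToEnds zero    (suc _) = refl
[+n%d]⊓[-n%d]≡distToEnds (suc m) d with suc m ℕ.% d
... | zero  = refl
... | suc r = refl

ℕ→ℚ[2^k]*Zigzag[n/2^k] : ∀ n k → ℕ→ℚ (2 ^ k) * Zigzag (n /2^ k) ≡ ℕ→ℚ (sawtooth n k)
ℕ→ℚ[2^k]*Zigzag[n/2^k] n k = trans (ℕ→ℚ[d]*Zigzag[i/d] (+ n) (2 ^ k)) (cong ℕ→ℚ ([+n%d]⊓[-n%d]≡distToEnds n (2 ^ k)))
  where instance _ = ℕₚ.m^n≢0 2 k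

Fsum≡sawtoothSum : ∀ n K → Fsum n K ≡ ℕ→ℚ (sawtoothSum n K)
Fsum≡sawtoothSum n zero = refl
Fsum≡sawtoothSum n (suc k) = begin
  Fsum n k + ℕ→ℚ (2 ^ suc k) * Zigzag (n /2^ suc k)   ≡⟨ cong₂ _+_ (Fsum≡sawtoothSum n k) (ℕ→ℚ[2^k]*Zigzag[n/2^k] n (suc k)) ⟩
  ℕ→ℚ (sawtoothSum n k) + ℕ→ℚ (sawtooth n (suc k))    ≡⟨ ℕ→ℚ-homo-+ (sawtoothSum n k) (sawtooth n (suc k)) ⟨
  ℕ→ℚ (sawtoothSum n (suc k))                          ∎
  where open ≡-Reasoning

F≡ℕ→ℚ[Fℕ] : ∀ n → F n ≡ ℕ→ℚ (Fℕ n)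
F≡ℕ→ℚ[Fℕ] n = Fsum≡sawtoothSum n ⌊log₂ n ⌋

a+f+o≡w+m⇒a-w≡m-o-f : ∀ a f o w m → a + f + o ≡ w + m → a - w ≡ m - o - f
a+f+o≡w+m⇒a-w≡m-o-f a f o w m eq = begin
  a - w                      ≡⟨ solve 4 (λ a f o w → a :- w := (a :+ f :+ o) :- w :- o :- f) refl a f o w ⟩
  (a + f + o) - w - o - f    ≡⟨ cong (λ x → x - w - o - f) eq ⟩
  (w + m) - w - o - f        ≡⟨ solve 4 (λ f o w m → (w :+ m) :- w :- o :- f := m :- o :- f) refl f o w m ⟩
  m - o - f                  ∎
  where
  open ≡-Reasoning
  open Data.Rational.Solver.+-*-Solver

ℕ→ℚ[2*B+Fℕ+1]≡ℕ→ℚ[W+n] : ∀ n .{{_ : NonZero n}} →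
  ℕ→ℚ 2 * ℕ→ℚ (B n) + ℕ→ℚ (Fℕ n) + ℕ→ℚ 1 ≡ ℕ→ℚ (W n) + ℕ→ℚ n
ℕ→ℚ[2*B+Fℕ+1]≡ℕ→ℚ[W+n] n = begin
  ℕ→ℚ 2 * ℕ→ℚ (B n) + ℕ→ℚ (Fℕ n) + ℕ→ℚ 1   ≡⟨ cong (λ x → x + ℕ→ℚ (Fℕ n) + ℕ→ℚ 1) (ℕ→ℚ-homo-* 2 (B n)) ⟨
  ℕ→ℚ (2 ℕ.* B n) + ℕ→ℚ (Fℕ n) + ℕ→ℚ 1     ≡⟨ cong (_+ ℕ→ℚ 1) (ℕ→ℚ-homo-+ (2 ℕ.* B n) (Fℕ n)) ⟨
  ℕ→ℚ (2 ℕ.* B n ℕ.+ Fℕ n) + ℕ→ℚ 1         ≡⟨ ℕ→ℚ-homo-+ (2 ℕ.* B n ℕ.+ Fℕ n) 1 ⟨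
  ℕ→ℚ (2 ℕ.* B n ℕ.+ Fℕ n ℕ.+ 1)           ≡⟨ cong ℕ→ℚ (2*B+Fℕ+1≡W+n n) ⟩
  ℕ→ℚ (W n ℕ.+ n)                           ≡⟨ ℕ→ℚ-homo-+ (W n) n ⟩
  ℕ→ℚ (W n) + ℕ→ℚ n                         ∎
  where open ≡-Reasoning

theorem5p1 : ∀ (n : ℕ) → .{{_ : NonZero n}} →
    ℕ→ℚ 2 * ℕ→ℚ (B n) - ℕ→ℚ (W n) ≡ ℕ→ℚ n - ℕ→ℚ 1 - F n
theorem5p1 n = begin
  ℕ→ℚ 2 * ℕ→ℚ (B n) - ℕ→ℚ (W n)
    ≡⟨ a+f+o≡w+m⇒a-w≡m-o-f (ℕ→ℚ 2 * ℕ→ℚ (B n)) (ℕ→ℚ (Fℕ n)) (ℕ→ℚ 1) (ℕ→ℚ (W n)) (ℕ→ℚ n) (ℕ→ℚ[2*B+Fℕ+1]≡ℕ→ℚ[W+n] n) ⟩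
  ℕ→ℚ n - ℕ→ℚ 1 - ℕ→ℚ (Fℕ n)
    ≡⟨ cong (λ x → ℕ→ℚ n - ℕ→ℚ 1 - x) (F≡ℕ→ℚ[Fℕ] n) ⟨
  ℕ→ℚ n - ℕ→ℚ 1 - F n
    ∎
  where open ≡-Reasoning
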